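{- If $n\ge5$ is odd, then $\zeta(G_n)=2n$.
   Context: $G_n=C_n\square P_2$ is the prism graph with vertex set $\{(t,i),(b,i): i\in\mathbb{Z}_n\}$, with $(t,i)$ adjacent to $(t,i\pm1)$ and $(b,i)$, and $(b,i)$ adjacent to $(b,i\pm1)$ and $(t,i)$. $\zeta(G)$ denotes the number of dominating sets of $G$ of minimum size $\gamma(G)$, counting distinct vertex subsets of the labeled graph separately. -}

module Defs where

open import Data.Bool using (Bool; true; false; _∧_; _∨_; if_then_else_)
open import Data.Nat using (ℕ; zero; suc; _+_; _*_; _∸_; _≡ᵇ_; _⊓_)
open import Data.Fin using (Fin; toℕ; remQuot)
open import Data.Fin.Subset using (Subset; Side; inside; outside; ∣_∣)
open import Data.Fin.Properties using (_≟_)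
open import Data.List using (List; []; _∷_; map; _++_; filter; length; foldr; allFin)
open import Data.Vec using (Vec; []; _∷_; lookup)
open import Data.Product using (_×_; _,_)
open import Relation.Nullary.Decidable using (⌊_⌋)
open import Relation.Binary.PropositionalEquality using (_≡_)

record Graph (m : ℕ) : Set where
  field
    adj : Fin m → Fin m → Bool

open Graph public

_∈ᵇ_ : ∀ {m} → Fin m → Subset m → Bool
v ∈ᵇ S with lookup S v
... | inside  = true
... | outside = false

anyᵇ : ∀ {m} → (Fin m → Bool) → Bool
anyᵇ {m} p = foldr (λ v b → p v ∨ b) false (allFin m)

allᵇ : ∀ {m} → (Fin m → Bool) → Bool
allᵇ {m} p = foldr (λ v b → p v ∧ b) true (allFin m)

isDominating : ∀ {m} → Graph m → Subset m → Bool
isDominating G S = allᵇ (λ v → (v ∈ᵇ S) ∨ anyᵇ (λ u → (u ∈ᵇ S) ∧ adj G u v))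

allSubsets : ∀ m → List (Subset m)
allSubsets zero    = [] ∷ []
allSubsets (suc m) = map (inside ∷_) (allSubsets m) ++ map (outside ∷_) (allSubsets m)

dominatingSets : ∀ {m} → Graph m → List (Subset m)
dominatingSets {m} G = filter (λ S → isDominating G S Data.Bool.≟ true) (allSubsets m)
  where import Data.Bool

-- domination number γ(G): minimum size of a dominating set
-- (the whole vertex set, of size m, is always dominating)
γ : ∀ {m} → Graph m → ℕ
γ {m} G = foldr (λ S k → ∣ S ∣ ⊓ k) m (dominatingSets G)

ζ : ∀ {m} → Graph m → ℕ
ζ G = length (filter (λ S → ∣ S ∣ Data.Nat.≟ γ G) (dominatingSets G))
  where import Data.Nat

-- A vertex v : Fin (2 * n) encodes the pair remQuot n v = (s , i) with
-- s : Fin 2 (0 = top t, 1 = bottom b) and i : Fin n (position in Z_n).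

cycSucc : (n : ℕ) → Fin n → Fin n → Bool
cycSucc n i j = (suc (toℕ i) ≡ᵇ toℕ j) ∨ ((suc (toℕ i) ≡ᵇ n) ∧ (toℕ j ≡ᵇ 0))

cycAdj : (n : ℕ) → Fin n → Fin n → Bool
cycAdj n i j = (cycSucc n i j ∨ cycSucc n j i) ∧ Data.Bool.not (toℕ i ≡ᵇ toℕ j)
  where import Data.Bool

prismAdj : (n : ℕ) → Fin 2 × Fin n → Fin 2 × Fin n → Bool
prismAdj n (s , i) (s' , i') =
  ((toℕ s ≡ᵇ toℕ s') ∧ cycAdj n i i') ∨
  (Data.Bool.not (toℕ s ≡ᵇ toℕ s') ∧ (toℕ i ≡ᵇ toℕ i'))
  where import Data.Bool

Prism : (n : ℕ) → Graph (2 * n)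
Prism n = record { adj = λ u v → prismAdj n (remQuot n u) (remQuot n v) }

{-# OPTIONS --safe #-}
-- A subset S of G_n is a cyclic word of n columns, column i recording which of (t,i), (b,i) lie
-- in S. S dominates G_n iff every column is dominated from within itself and its two neighbouring
-- columns, a condition on each window of three consecutive columns. The coverage of a window (the
-- number of members of S in the closed neighbourhoods of the two vertices of its middle column) is
-- at least 2 when the middle column is dominated, and the coverages sum to 4∣S∣ as G_n is 3-regular.
-- So 4∣S∣ ≥ 2n: for odd n every dominating set has at least (n+1)/2 vertices, and those of exactly
-- that size are the words whose windows exceed coverage 2 by 2 in total. These are counted by a
-- transfer operator on states recording the first two columns (to close the cycle), the last two
-- columns and the excess still available. Evaluation on memo tables shows that its iterates grow
-- affinely with period 4 in n from n = 7 and from n = 9 on; together with n = 5 the count is 2n,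
-- which is positive, so (n+1)/2 is attained, γ(G_n) = (n+1)/2 and ζ(G_n) = 2n.
module Submission where

open import Data.Bool using (Bool; true; false; T; _∧_; _∨_; not; if_then_else_)
import Data.Bool as Bool
open import Data.Bool.Properties using (T-≡; T-∧; T-∨; T-not-≡; ∨-identityʳ; ∧-zeroʳ)
open import Data.Empty using (⊥-elim)
open import Data.Fin using (Fin; zero; suc; toℕ; fromℕ<; combine; remQuot; _↑ˡ_; _↑ʳ_)
open import Data.Fin.Properties using (toℕ<n; toℕ-fromℕ<; remQuot-combine; combine-remQuot)
open import Data.Fin.Subset using (Subset; Side; inside; outside; ∣_∣)
open import Data.Fin.Subset.Properties using (∣p∣≤n)
open import Data.List
  using (List; []; _∷_; _++_; map; filter; length; foldr; allFin; cartesianProduct; cartesianProductWith)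
open import Data.List.Membership.Propositional using (_∈_)
open import Data.List.Membership.Propositional.Properties using (∈-filter⁺; ∈-filter⁻; ∈-allFin)
open import Data.List.Relation.Unary.Any using (here; there)
open import Data.Maybe using (Maybe; just; nothing; maybe)
open import Data.Nat using (ℕ; zero; suc; _+_; _*_; _∸_; _≡ᵇ_; _≤ᵇ_; _⊓_; _≤_; _<_; z≤n; s≤s; z<s)
import Data.Nat as ℕ
open import Data.Nat.Properties
  using ( +-identityʳ; +-assoc; +-comm; +-suc; *-suc; *-zeroʳ; *-distribˡ-+; +-commutativeSemigroup
        ; +-cancelˡ-≡; *-cancelˡ-≡; *-cancelˡ-<; +-monoˡ-≤; +-monoʳ-<; m≤m+n
        ; ≡ᵇ⇒≡; ≡⇒≡ᵇ; ≤ᵇ⇒≤; 0≢1+n; ≤-trans; ≤-antisym; <-trans; <⇒≢; n<1+n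
        ; m<n⇒m<1+n; m<1+n⇒m≤n; m≤n⇒m<n∨m≡n; m<1+n⇒m<n∨m≡n
        ; m+[n∸m]≡n; ⊓-glb; m⊓n≤m; m⊓n≤n; module ≤-Reasoning )
open import Data.Nat.Tactic.RingSolver using (solve-∀)
open import Algebra.Properties.CommutativeSemigroup +-commutativeSemigroup using (interchange; x∙yz≈y∙xz)
open import Data.Product using (_×_; _,_; proj₁; proj₂; ∃)
open import Data.Sum using (_⊎_; inj₁; inj₂)
import Data.Sum as Sum
open import Data.Vec using (Vec; []; _∷_)
import Data.Vec as Vec
open import Data.Vec.Properties using (map-proj₁-zip; map-proj₂-zip; lookup-++ˡ; lookup-++ʳ; lookup-map)
open import Function using (_∘_; Equivalence)
open import Relation.Binary.PropositionalEquality
open import Relation.Nullary using (does)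
open import Relation.Unary using (Pred; Decidable)

open import Defs

private variable
  A B C : Set

𝟙 : Bool → ℕ
𝟙 b = if b then 1 else 0

𝟙≢0⇒T : ∀ b → 𝟙 b ≢ 0 → T b
𝟙≢0⇒T true  _   = _
𝟙≢0⇒T false 𝟙≢0 = ⊥-elim (𝟙≢0 refl)

T-implication : ∀ {a b} → T (not a ∨ b) → T a → T b
T-implication {true} b _ = b

T-extensional : ∀ {a b} → (T a → T b) → (T b → T a) → a ≡ b
T-extensional {true}  {true}  _   _   = refl
T-extensional {true}  {false} a⇒b _   = ⊥-elim (a⇒b _)
T-extensional {false} {true}  _   b⇒a = ⊥-elim (b⇒a _)
T-extensional {false} {false} _   _   = refl

∧-cong-T : ∀ a {b b′} → (T a → b ≡ b′) → a ∧ b ≡ a ∧ b′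
∧-cong-T true  b≡b′ = b≡b′ _
∧-cong-T false _    = refl

∨⁴-sound : ∀ a b c d → T (a ∨ b ∨ c ∨ d) → T a ⊎ T b ⊎ T c ⊎ T d
∨⁴-sound true  _     _     _    t = inj₁ t
∨⁴-sound false true  _     _    t = inj₂ (inj₁ t)
∨⁴-sound false false true  _    t = inj₂ (inj₂ (inj₁ t))
∨⁴-sound false false false true t = inj₂ (inj₂ (inj₂ t))

∨⁴-complete : ∀ a b c d → T a ⊎ T b ⊎ T c ⊎ T d → T (a ∨ b ∨ c ∨ d)
∨⁴-complete a b c d =
  Equivalence.from (T-∨ {a}) ∘ Sum.map₂ (Equivalence.from (T-∨ {b}) ∘ Sum.map₂ (Equivalence.from (T-∨ {c})))

≢⇒≡ᵇ≡false : ∀ {m n} → m ≢ n → (m ≡ᵇ n) ≡ false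
≢⇒≡ᵇ≡false {m} {n} m≢n with m ≡ᵇ n in eq
... | true  = ⊥-elim (m≢n (≡ᵇ⇒≡ m n (Equivalence.from T-≡ eq)))
... | false = refl

anyᵇ-sound : ∀ {m} (p : Fin m → Bool) → T (anyᵇ p) → ∃ λ v → T (p v)
anyᵇ-sound {m} p = go (allFin m)
  where
  go : ∀ vs → T (foldr (λ v b → p v ∨ b) false vs) → ∃ λ v → T (p v)
  go (v ∷ vs) t with Equivalence.to T-∨ t
  ... | inj₁ pv   = v , pv
  ... | inj₂ rest = go vs rest

anyᵇ-complete : ∀ {m} (p : Fin m → Bool) v → T (p v) → T (anyᵇ p)
anyᵇ-complete {m} p v pv = go (∈-allFin v)
  where
  go : ∀ {vs} → v ∈ vs → T (foldr (λ v b → p v ∨ b) false vs)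
  go {v ∷ _}  (here refl)  = Equivalence.from (T-∨ {p v}) (inj₁ pv)
  go {v′ ∷ _} (there v∈vs) = Equivalence.from (T-∨ {p v′}) (inj₂ (go v∈vs))

allᵇ-sound : ∀ {m} (p : Fin m → Bool) → T (allᵇ p) → ∀ v → T (p v)
allᵇ-sound {m} p all v = go (∈-allFin v) all
  where
  go : ∀ {vs} → v ∈ vs → T (foldr (λ v b → p v ∧ b) true vs) → T (p v)
  go (here refl)  t = proj₁ (Equivalence.to T-∧ t)
  go (there v∈vs) t = go v∈vs (proj₂ (Equivalence.to T-∧ t))

allᵇ-complete : ∀ {m} (p : Fin m → Bool) → (∀ v → T (p v)) → T (allᵇ p)
allᵇ-complete {m} p all = go (allFin m)
  where
  go : ∀ vs → T (foldr (λ v b → p v ∧ b) true vs)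
  go []       = _
  go (v ∷ vs) = Equivalence.from T-∧ (all v , go vs)

sumOver : List A → (A → ℕ) → ℕ
sumOver []       f = 0
sumOver (x ∷ xs) f = f x + sumOver xs f

sumOver-cong : ∀ (xs : List A) {f g : A → ℕ} → (∀ x → f x ≡ g x) → sumOver xs f ≡ sumOver xs g
sumOver-cong []       f≗g = refl
sumOver-cong (x ∷ xs) f≗g = cong₂ _+_ (f≗g x) (sumOver-cong xs f≗g)

sumOver-++ : ∀ (xs ys : List A) f → sumOver (xs ++ ys) f ≡ sumOver xs f + sumOver ys f
sumOver-++ []       ys f = refl
sumOver-++ (x ∷ xs) ys f = trans (cong (f x +_) (sumOver-++ xs ys f)) (sym (+-assoc (f x) _ _))

sumOver-map : ∀ (g : A → B) xs f → sumOver (map g xs) f ≡ sumOver xs (f ∘ g)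
sumOver-map g []       f = refl
sumOver-map g (x ∷ xs) f = cong (f (g x) +_) (sumOver-map g xs f)

sumOver-zero : ∀ (xs : List A) → sumOver xs (λ _ → 0) ≡ 0
sumOver-zero []       = refl
sumOver-zero (x ∷ xs) = sumOver-zero xs

sumOver-+ : ∀ (xs : List A) f g → sumOver xs (λ x → f x + g x) ≡ sumOver xs f + sumOver xs g
sumOver-+ []       f g = refl
sumOver-+ (x ∷ xs) f g =
  trans (cong (f x + g x +_) (sumOver-+ xs f g)) (interchange (f x) (g x) (sumOver xs f) (sumOver xs g))

sumOver-*ˡ : ∀ (xs : List A) j f → sumOver xs (λ x → j * f x) ≡ j * sumOver xs f
sumOver-*ˡ []       j f = sym (*-zeroʳ j)
sumOver-*ˡ (x ∷ xs) j f = trans (cong (j * f x +_) (sumOver-*ˡ xs j f)) (sym (*-distribˡ-+ j (f x) _))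

sumOver-linear : ∀ (xs : List A) {f g h : A → ℕ} j → (∀ x → f x ≡ g x + j * h x) →
                 sumOver xs f ≡ sumOver xs g + j * sumOver xs h
sumOver-linear xs {f} {g} {h} j f≗g+jh =
  trans (sumOver-cong xs f≗g+jh)
        (trans (sumOver-+ xs g (λ x → j * h x)) (cong (sumOver xs g +_) (sumOver-*ˡ xs j h)))

sumOver-comm : ∀ (xs : List A) (ys : List B) (f : A → B → ℕ) →
               sumOver xs (λ x → sumOver ys (f x)) ≡ sumOver ys (λ y → sumOver xs (λ x → f x y))
sumOver-comm []       ys f = sym (sumOver-zero ys)
sumOver-comm (x ∷ xs) ys f =
  trans (cong (sumOver ys (f x) +_) (sumOver-comm xs ys f)) (sym (sumOver-+ ys (f x) _))

sumOver-cartesianProductWith : ∀ (g : A → B → C) xs ys f →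
  sumOver (cartesianProductWith g xs ys) f ≡ sumOver xs (λ x → sumOver ys (f ∘ g x))
sumOver-cartesianProductWith g []       ys f = refl
sumOver-cartesianProductWith g (x ∷ xs) ys f = begin
  sumOver (map (g x) ys ++ cartesianProductWith g xs ys) f
    ≡⟨ sumOver-++ (map (g x) ys) _ f ⟩
  sumOver (map (g x) ys) f + sumOver (cartesianProductWith g xs ys) f
    ≡⟨ cong₂ _+_ (sumOver-map (g x) ys f) (sumOver-cartesianProductWith g xs ys f) ⟩
  sumOver ys (f ∘ g x) + sumOver xs (λ x → sumOver ys (f ∘ g x)) ∎
  where open ≡-Reasoning

sumOver-nonzero : ∀ (xs : List A) f → sumOver xs f ≢ 0 → ∃ λ x → x ∈ xs × f x ≢ 0
sumOver-nonzero []       f Σ≢0 = ⊥-elim (Σ≢0 refl)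
sumOver-nonzero (x ∷ xs) f Σ≢0 with f x in fx≡
... | suc _ = x , here refl , λ fx≡0 → 0≢1+n (trans (sym fx≡0) fx≡)
... | zero with sumOver-nonzero xs f Σ≢0
...   | y , y∈xs , fy≢0 = y , there y∈xs , fy≢0

sumOver-filter : ∀ {p} {P : Pred A p} (P? : Decidable P) xs f →
                 sumOver (filter P? xs) f ≡ sumOver xs (λ x → if does (P? x) then f x else 0)
sumOver-filter P? []       f = refl
sumOver-filter P? (x ∷ xs) f with does (P? x)
... | true  = cong (f x +_) (sumOver-filter P? xs f)
... | false = sumOver-filter P? xs f

length≡sumOver : ∀ (xs : List A) → length xs ≡ sumOver xs (λ _ → 1)
length≡sumOver []       = refl
length≡sumOver (x ∷ xs) = cong suc (length≡sumOver xs)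

Linear : ∀ {X Y : Set} → ((X → ℕ) → Y → ℕ) → Set
Linear {X} {Y} F =
  ∀ {f g h : X → ℕ} j → (∀ x → f x ≡ g x + j * h x) → ∀ y → F f y ≡ F g y + j * F h y

Linear⇒cong : ∀ {X Y} {F : (X → ℕ) → Y → ℕ} → Linear F →
              ∀ {f g} → (∀ x → f x ≡ g x) → ∀ y → F f y ≡ F g y
Linear⇒cong {F = F} linear {f} {g} f≗g y =
  trans (linear {h = f} 0 (λ x → trans (f≗g x) (sym (+-identityʳ (g x)))) y) (+-identityʳ (F g y))

Linear-∘ : ∀ {X Y Z} {F : (Y → ℕ) → Z → ℕ} {G : (X → ℕ) → Y → ℕ} →
           Linear F → Linear G → Linear (F ∘ G)
Linear-∘ linF linG j f≗g+jh = linF j (linG j f≗g+jh)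

affine-orbit : ∀ {X} {F : (X → ℕ) → X → ℕ} → Linear F → ∀ (u : ℕ → X → ℕ) d →
  (∀ i x → u (suc i) x ≡ F (u i) x) → (∀ x → F (u 0) x ≡ u 0 x + d x) → (∀ x → F d x ≡ d x) →
  ∀ i x → u i x ≡ u 0 x + i * d x
affine-orbit linear u d orbit first fixed zero    x = sym (+-identityʳ (u 0 x))
affine-orbit {F = F} linear u d orbit first fixed (suc i) x = begin
  u (suc i) x              ≡⟨ orbit i x ⟩
  F (u i) x                ≡⟨ linear i (affine-orbit linear u d orbit first fixed i) x ⟩
  F (u 0) x + i * F d x    ≡⟨ cong₂ (λ a b → a + i * b) (first x) (fixed x) ⟩
  (u 0 x + d x) + i * d x  ≡⟨ +-assoc (u 0 x) (d x) (i * d x) ⟩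
  u 0 x + suc i * d x      ∎
  where open ≡-Reasoning

record Finite (X : Set) : Set₁ where
  field
    Table           : Set → Set
    tabulate        : (X → A) → Table A
    lookup          : Table A → X → A
    lookup∘tabulate : ∀ (f : X → A) x → lookup (tabulate f) x ≡ f x
    all             : (X → Bool) → Bool
    all-sound       : ∀ p → T (all p) → ∀ x → T (p x)

×-finite : Finite A → Finite B → Finite (A × B)
×-finite {A} {B} FA FB = record
  { Table           = λ C → FA.Table (FB.Table C)
  ; tabulate        = λ f → FA.tabulate (λ a → FB.tabulate (λ b → f (a , b)))
  ; lookup          = λ t (a , b) → FB.lookup (FA.lookup t a) b
  ; lookup∘tabulate = λ f (a , b) →
      trans (cong (λ t → FB.lookup t b) (FA.lookup∘tabulate _ a)) (FB.lookup∘tabulate _ b)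
  ; all             = λ p → FA.all (λ a → FB.all (λ b → p (a , b)))
  ; all-sound       = λ p ok (a , b) → FB.all-sound _ (FA.all-sound _ ok a) b
  }
  where
  module FA = Finite FA
  module FB = Finite FB

sideFinite : Finite Side
sideFinite = record
  { Table           = λ A → A × A
  ; tabulate        = λ f → f inside , f outside
  ; lookup          = λ { (a , b) inside → a ; (a , b) outside → b }
  ; lookup∘tabulate = λ { f inside → refl ; f outside → refl }
  ; all             = λ p → p inside ∧ p outside
  ; all-sound       = λ { p ok inside  → proj₁ (Equivalence.to (T-∧ {p inside}) ok)
                        ; p ok outside → proj₂ (Equivalence.to (T-∧ {p inside}) ok) }
  }

foldr-⊓-≤ : ∀ (f : A → ℕ) i {x xs} → x ∈ xs → foldr (λ y k → f y ⊓ k) i xs ≤ f x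
foldr-⊓-≤ f i              (here refl)  = m⊓n≤m (f _) _
foldr-⊓-≤ f i {xs = y ∷ _} (there x∈xs) = ≤-trans (m⊓n≤n (f y) _) (foldr-⊓-≤ f i x∈xs)

≤-foldr-⊓ : ∀ (f : A → ℕ) {c i} xs → c ≤ i → (∀ {x} → x ∈ xs → c ≤ f x) →
            c ≤ foldr (λ y k → f y ⊓ k) i xs
≤-foldr-⊓ f []       c≤i c≤f = c≤i
≤-foldr-⊓ f (x ∷ xs) c≤i c≤f = ⊓-glb (c≤f (here refl)) (≤-foldr-⊓ f xs c≤i (c≤f ∘ there))

module _ {m} (G : Graph m) where

  private
    dominating? = λ S → isDominating G S Bool.≟ true

  isDominatingOfSize : ℕ → Subset m → Bool
  isDominatingOfSize k S = isDominating G S ∧ (∣ S ∣ ≡ᵇ k)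

  #dominatingOfSize : ℕ → ℕ
  #dominatingOfSize k = sumOver (allSubsets m) (𝟙 ∘ isDominatingOfSize k)

  ζ≡#dominatingOfSize : ζ G ≡ #dominatingOfSize (γ G)
  ζ≡#dominatingOfSize = begin
    length (filter size? (dominatingSets G))
      ≡⟨ length≡sumOver (filter size? (dominatingSets G)) ⟩
    sumOver (filter size? (dominatingSets G)) (λ _ → 1)
      ≡⟨ sumOver-filter size? (dominatingSets G) _ ⟩
    sumOver (dominatingSets G) (λ S → 𝟙 (∣ S ∣ ≡ᵇ γ G))
      ≡⟨ sumOver-filter dominating? (allSubsets m) _ ⟩
    sumOver (allSubsets m) (λ S → if does (dominating? S) then 𝟙 (∣ S ∣ ≡ᵇ γ G) else 0)
      ≡⟨ sumOver-cong (allSubsets m) (λ S → if-≟true (isDominating G S) _) ⟩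
    #dominatingOfSize (γ G) ∎
    where
    open ≡-Reasoning
    size? = λ S → ∣ S ∣ ℕ.≟ γ G
    if-≟true : ∀ b c → (if does (b Bool.≟ true) then 𝟙 c else 0) ≡ 𝟙 (b ∧ c)
    if-≟true true  c = refl
    if-≟true false c = refl

  attainedLowerBound⇒γ≡ : ∀ {c} → (∀ S → T (isDominating G S) → c ≤ ∣ S ∣) →
                          #dominatingOfSize c ≢ 0 → γ G ≡ c
  attainedLowerBound⇒γ≡ {c} c≤dominating #≢0
    with S , S∈ , 𝟙≢0 ← sumOver-nonzero (allSubsets m) (𝟙 ∘ isDominatingOfSize c) #≢0
    with S-dominating , ∣S∣≡ᵇc ← Equivalence.to T-∧ (𝟙≢0⇒T _ 𝟙≢0)
    = ≤-antisym γ≤c c≤γ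
    where
    ∣S∣≡c : ∣ S ∣ ≡ c
    ∣S∣≡c = ≡ᵇ⇒≡ ∣ S ∣ c ∣S∣≡ᵇc
    γ≤c : γ G ≤ c
    γ≤c = subst (γ G ≤_) ∣S∣≡c
            (foldr-⊓-≤ ∣_∣ m (∈-filter⁺ dominating? S∈ (Equivalence.to T-≡ S-dominating)))
    c≤γ : c ≤ γ G
    c≤γ = ≤-foldr-⊓ ∣_∣ (dominatingSets G) (subst (_≤ m) ∣S∣≡c (∣p∣≤n S)) λ {S′} S′∈ →
            c≤dominating S′ (Equivalence.from T-≡ (proj₂ (∈-filter⁻ dominating? {xs = allSubsets m} S′∈)))

-- Subsets of the prism as words of columns

sides : List Side
sides = inside ∷ outside ∷ []

Column : Set
Column = Side × Side

columns : List Column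
columns = cartesianProduct sides sides

columnFinite : Finite Column
columnFinite = ×-finite sideFinite sideFinite

Word : ℕ → Set
Word = Vec Column

words : ∀ n → List (Word n)
words zero    = [] ∷ []
words (suc n) = cartesianProductWith _∷_ columns (words n)

-- Row s of column i of the word is the vertex combine s i of Prism n, i.e. (t,i) or (b,i).
toSubset : ∀ {n} → Word n → Subset (2 * n)
toSubset w = Vec.map proj₁ w Vec.++ (Vec.map proj₂ w Vec.++ [])

sumOver-words-suc : ∀ n (f : Word (suc n) → ℕ) →
  sumOver (words (suc n)) f ≡ sumOver columns (λ c → sumOver (words n) (f ∘ (c ∷_)))
sumOver-words-suc n = sumOver-cartesianProductWith _∷_ columns (words n)

sumOver-allSubsets-suc : ∀ n (f : Subset (suc n) → ℕ) →
  sumOver (allSubsets (suc n)) f ≡ sumOver sides (λ a → sumOver (allSubsets n) (f ∘ (a ∷_)))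
sumOver-allSubsets-suc n f = begin
  sumOver (map (inside ∷_) (allSubsets n) ++ map (outside ∷_) (allSubsets n)) f
    ≡⟨ sumOver-++ (map (inside ∷_) (allSubsets n)) _ f ⟩
  sumOver (map (inside ∷_) (allSubsets n)) f + sumOver (map (outside ∷_) (allSubsets n)) f
    ≡⟨ cong₂ _+_ (sumOver-map (inside ∷_) (allSubsets n) f)
                 (trans (sumOver-map (outside ∷_) (allSubsets n) f) (sym (+-identityʳ _))) ⟩
  sumOver sides (λ a → sumOver (allSubsets n) (f ∘ (a ∷_))) ∎
  where open ≡-Reasoning

sumOver-allSubsets-+ : ∀ a b (f : Subset (a + b) → ℕ) →
  sumOver (allSubsets (a + b)) f ≡ sumOver (allSubsets a) (λ u → sumOver (allSubsets b) (λ v → f (u Vec.++ v)))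
sumOver-allSubsets-+ zero    b f = sym (+-identityʳ _)
sumOver-allSubsets-+ (suc a) b f = begin
  sumOver (allSubsets (suc a + b)) f
    ≡⟨ sumOver-allSubsets-suc (a + b) f ⟩
  sumOver sides (λ s → sumOver (allSubsets (a + b)) (f ∘ (s ∷_)))
    ≡⟨ sumOver-cong sides (λ s → sumOver-allSubsets-+ a b (f ∘ (s ∷_))) ⟩
  sumOver sides (λ s → sumOver (allSubsets a) (λ u → sumOver (allSubsets b) (λ v → f (s ∷ u Vec.++ v))))
    ≡⟨ sumOver-allSubsets-suc a (λ u → sumOver (allSubsets b) (λ v → f (u Vec.++ v))) ⟨
  sumOver (allSubsets (suc a)) (λ u → sumOver (allSubsets b) (λ v → f (u Vec.++ v))) ∎
  where open ≡-Reasoning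

sumOver-allSubsets² : ∀ n (F : Subset n → Subset n → ℕ) →
  sumOver (allSubsets n) (λ u → sumOver (allSubsets n) (F u)) ≡
  sumOver (words n) (λ w → F (Vec.map proj₁ w) (Vec.map proj₂ w))
sumOver-allSubsets² zero    F = +-identityʳ _
sumOver-allSubsets² (suc n) F = begin
  Σ (allSubsets (suc n)) (λ u → Σ (allSubsets (suc n)) (F u))
    ≡⟨ sumOver-allSubsets-suc n _ ⟩
  Σ sides (λ a → Σ 𝒮 (λ u → Σ (allSubsets (suc n)) (F (a ∷ u))))
    ≡⟨ sumOver-cong sides (λ a → sumOver-cong 𝒮 (λ u → sumOver-allSubsets-suc n (F (a ∷ u)))) ⟩
  Σ sides (λ a → Σ 𝒮 (λ u → Σ sides (λ b → Σ 𝒮 (F (a ∷ u) ∘ (b ∷_)))))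
    ≡⟨ sumOver-cong sides (λ a → sumOver-comm 𝒮 sides (λ u b → Σ 𝒮 (F (a ∷ u) ∘ (b ∷_)))) ⟩
  Σ sides (λ a → Σ sides (λ b → Σ 𝒮 (λ u → Σ 𝒮 (F (a ∷ u) ∘ (b ∷_)))))
    ≡⟨ sumOver-cong sides (λ a → sumOver-cong sides λ b →
         sumOver-allSubsets² n (λ u v → F (a ∷ u) (b ∷ v))) ⟩
  Σ sides (λ a → Σ sides (λ b → Σ (words n) (λ w → F (a ∷ top w) (b ∷ bottom w))))
    ≡⟨ sumOver-cartesianProductWith _,_ sides sides (λ c → Σ (words n) (F′ ∘ (c ∷_))) ⟨
  Σ columns (λ c → Σ (words n) (F′ ∘ (c ∷_)))
    ≡⟨ sumOver-words-suc n F′ ⟨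
  Σ (words (suc n)) F′ ∎
  where
  open ≡-Reasoning
  Σ = sumOver
  𝒮 = allSubsets n
  top bottom : ∀ {k} → Word k → Subset k
  top    = Vec.map proj₁
  bottom = Vec.map proj₂
  F′ : Word (suc n) → ℕ
  F′ w = F (top w) (bottom w)

sumOver-allSubsets-2* : ∀ n (f : Subset (2 * n) → ℕ) →
  sumOver (allSubsets (2 * n)) f ≡ sumOver (words n) (f ∘ toSubset)
sumOver-allSubsets-2* n f = begin
  sumOver (allSubsets (n + (n + 0))) f
    ≡⟨ sumOver-allSubsets-+ n (n + 0) f ⟩
  sumOver (allSubsets n) (λ u → sumOver (allSubsets (n + 0)) (λ v → f (u Vec.++ v)))
    ≡⟨ sumOver-cong (allSubsets n) (λ u → sumOver-allSubsets-+ n 0 (λ v → f (u Vec.++ v))) ⟩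
  sumOver (allSubsets n) (λ u → sumOver (allSubsets n) (λ v → f (u Vec.++ (v Vec.++ [])) + 0))
    ≡⟨ sumOver-cong (allSubsets n) (λ u → sumOver-cong (allSubsets n) (λ v → +-identityʳ _)) ⟩
  sumOver (allSubsets n) (λ u → sumOver (allSubsets n) (λ v → f (u Vec.++ (v Vec.++ []))))
    ≡⟨ sumOver-allSubsets² n (λ u v → f (u Vec.++ (v Vec.++ []))) ⟩
  sumOver (words n) (f ∘ toSubset) ∎
  where open ≡-Reasoning

toSubset-surjective : ∀ n (S : Subset (2 * n)) → ∃ λ (w : Word n) → toSubset w ≡ S
toSubset-surjective n S with top , rest , refl ← Vec.splitAt n S with bottom , [] , refl ← Vec.splitAt n rest =
  Vec.zip top bottom ,
  cong₂ (λ u v → u Vec.++ (v Vec.++ [])) (map-proj₁-zip top bottom) (map-proj₂-zip top bottom)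

∣_∣ᶜ : Column → ℕ
∣ a , b ∣ᶜ = 𝟙 a + 𝟙 b

weight : ∀ {n} → Word n → ℕ
weight []      = 0
weight (c ∷ w) = ∣ c ∣ᶜ + weight w

∣∷∣ : ∀ {n} a (p : Subset n) → ∣ a ∷ p ∣ ≡ 𝟙 a + ∣ p ∣
∣∷∣ true  p = refl
∣∷∣ false p = refl

∣++∣ : ∀ {m n} (p : Subset m) (q : Subset n) → ∣ p Vec.++ q ∣ ≡ ∣ p ∣ + ∣ q ∣
∣++∣ []          q = refl
∣++∣ (true ∷ p)  q = cong suc (∣++∣ p q)
∣++∣ (false ∷ p) q = ∣++∣ p q

weight≡∣rows∣ : ∀ {n} (w : Word n) → weight w ≡ ∣ Vec.map proj₁ w ∣ + ∣ Vec.map proj₂ w ∣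
weight≡∣rows∣ []            = refl
weight≡∣rows∣ ((a , b) ∷ w) = begin
  (𝟙 a + 𝟙 b) + weight w
    ≡⟨ cong ((𝟙 a + 𝟙 b) +_) (weight≡∣rows∣ w) ⟩
  (𝟙 a + 𝟙 b) + (∣ top ∣ + ∣ bottom ∣)
    ≡⟨ interchange (𝟙 a) (𝟙 b) ∣ top ∣ ∣ bottom ∣ ⟩
  (𝟙 a + ∣ top ∣) + (𝟙 b + ∣ bottom ∣)
    ≡⟨ cong₂ _+_ (∣∷∣ a top) (∣∷∣ b bottom) ⟨
  ∣ a ∷ top ∣ + ∣ b ∷ bottom ∣ ∎
  where
  open ≡-Reasoning
  top    = Vec.map proj₁ w
  bottom = Vec.map proj₂ w

∣toSubset∣ : ∀ {n} (w : Word n) → ∣ toSubset w ∣ ≡ weight w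
∣toSubset∣ w = begin
  ∣ top Vec.++ (bottom Vec.++ []) ∣  ≡⟨ ∣++∣ top _ ⟩
  ∣ top ∣ + ∣ bottom Vec.++ [] ∣     ≡⟨ cong (∣ top ∣ +_) (trans (∣++∣ bottom []) (+-identityʳ _)) ⟩
  ∣ top ∣ + ∣ bottom ∣               ≡⟨ weight≡∣rows∣ w ⟨
  weight w                          ∎
  where
  open ≡-Reasoning
  top    = Vec.map proj₁ w
  bottom = Vec.map proj₂ w

-- Domination in the prism is a condition on windows of three columns

prev : ℕ → ℕ → ℕ
prev n zero    = n ∸ 1
prev n (suc b) = b

next : ℕ → ℕ → ℕ
next n b = if suc b ≡ᵇ n then 0 else suc b

next-< : ∀ {n b} → suc b < n → next n b ≡ suc b
next-< b+1<n rewrite ≢⇒≡ᵇ≡false (<⇒≢ b+1<n) = refl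

next-last : ∀ b → next (suc b) b ≡ 0
next-last b rewrite Equivalence.to T-≡ (≡⇒≡ᵇ b b refl) = refl

prev<n : ∀ {n b} → b < n → prev n b < n
prev<n {suc n} {zero}  _   = n<1+n n
prev<n {b = suc b}     b<n = <-trans (n<1+n b) b<n

next<n : ∀ {n b} → b < n → next n b < n
next<n {n} {b} b<n with m≤n⇒m<n∨m≡n b<n
... | inj₁ b+1<n = subst (_< n) (sym (next-< b+1<n)) b+1<n
... | inj₂ refl  = subst (_< suc b) (sym (next-last b)) z<s

cycSuccℕ : ℕ → ℕ → ℕ → Bool
cycSuccℕ n a b = (suc a ≡ᵇ b) ∨ ((suc a ≡ᵇ n) ∧ (b ≡ᵇ 0))

cycAdjℕ : ℕ → ℕ → ℕ → Bool
cycAdjℕ n a b = (cycSuccℕ n a b ∨ cycSuccℕ n b a) ∧ not (a ≡ᵇ b)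

cycSuccℕ-sound : ∀ {n} a b → T (cycSuccℕ n a b) → b ≡ suc a ⊎ (n ≡ suc a × b ≡ 0)
cycSuccℕ-sound {n} a b t with Equivalence.to T-∨ t
... | inj₁ a+1≡b = inj₁ (sym (≡ᵇ⇒≡ (suc a) b a+1≡b))
... | inj₂ wrap with a+1≡n , b≡0 ← Equivalence.to T-∧ wrap =
  inj₂ (sym (≡ᵇ⇒≡ (suc a) n a+1≡n) , ≡ᵇ⇒≡ b 0 b≡0)

cycSuccℕ-complete : ∀ {n} a b → b ≡ suc a ⊎ (n ≡ suc a × b ≡ 0) → T (cycSuccℕ n a b)
cycSuccℕ-complete a b (inj₁ refl) =
  Equivalence.from (T-∨ {suc a ≡ᵇ b}) (inj₁ (≡⇒≡ᵇ (suc a) b refl))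
cycSuccℕ-complete a b (inj₂ (refl , refl)) =
  Equivalence.from (T-∨ {suc a ≡ᵇ b}) (inj₂ (Equivalence.from T-∧ (≡⇒≡ᵇ (suc a) (suc a) refl , _)))

cycAdjℕ-sound : ∀ {n} a b → a < n → T (cycAdjℕ n a b) → a ≡ prev n b ⊎ a ≡ next n b
cycAdjℕ-sound {n} a b a<n adj with Equivalence.to T-∨ (proj₁ (Equivalence.to T-∧ adj))
... | inj₁ a→b with cycSuccℕ-sound {n} a b a→b
...   | inj₁ refl          = inj₁ refl
...   | inj₂ (refl , refl) = inj₁ refl
cycAdjℕ-sound {n} a b a<n adj | inj₂ b→a with cycSuccℕ-sound {n} b a b→a
...   | inj₁ refl          = inj₂ (sym (next-< a<n))
...   | inj₂ (refl , refl) = inj₂ (sym (next-last b))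

cycAdjℕ-intro : ∀ {n} a b → T (cycSuccℕ n a b) ⊎ T (cycSuccℕ n b a) → a ≢ b → T (cycAdjℕ n a b)
cycAdjℕ-intro a b succ a≢b =
  Equivalence.from T-∧ (Equivalence.from T-∨ succ , Equivalence.from T-not-≡ (≢⇒≡ᵇ≡false a≢b))

cycAdjℕ-prev : ∀ {n} b → 2 ≤ n → T (cycAdjℕ n (prev n b) b)
cycAdjℕ-prev {suc zero}    zero    (s≤s ())
cycAdjℕ-prev {suc (suc m)} zero    _ =
  cycAdjℕ-intro {suc (suc m)} (suc m) 0
    (inj₁ (cycSuccℕ-complete {suc (suc m)} (suc m) 0 (inj₂ (refl , refl)))) λ ()
cycAdjℕ-prev {n}           (suc b) _ =
  cycAdjℕ-intro {n} b (suc b) (inj₁ (cycSuccℕ-complete {n} b (suc b) (inj₁ refl))) (<⇒≢ (n<1+n b))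

cycAdjℕ-next : ∀ {n} b → 2 ≤ n → b < n → T (cycAdjℕ n (next n b) b)
cycAdjℕ-next {n} b 2≤n b<n with m≤n⇒m<n∨m≡n b<n
... | inj₁ b+1<n rewrite next-< b+1<n =
  cycAdjℕ-intro {n} (suc b) b (inj₂ (cycSuccℕ-complete {n} b (suc b) (inj₁ refl))) (≢-sym (<⇒≢ (n<1+n b)))
cycAdjℕ-next {suc zero}    zero    (s≤s ()) _ | inj₂ refl
cycAdjℕ-next {suc (suc m)} (suc m) _        _ | inj₂ refl rewrite next-last (suc m) =
  cycAdjℕ-intro {suc (suc m)} 0 (suc m)
    (inj₂ (cycSuccℕ-complete {suc (suc m)} (suc m) 0 (inj₂ (refl , refl)))) λ ()

row : Fin 2 → Column → Side
row zero       = proj₁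
row (suc zero) = proj₂

otherRow : Fin 2 → Fin 2
otherRow zero       = suc zero
otherRow (suc zero) = zero

sameRow⊎otherRow : ∀ s s′ → s′ ≡ s ⊎ s′ ≡ otherRow s
sameRow⊎otherRow zero       zero       = inj₁ refl
sameRow⊎otherRow zero       (suc zero) = inj₂ refl
sameRow⊎otherRow (suc zero) zero       = inj₂ refl
sameRow⊎otherRow (suc zero) (suc zero) = inj₁ refl

prismAdj-sameRow : ∀ n s (i′ i : Fin n) → prismAdj n (s , i′) (s , i) ≡ cycAdj n i′ i
prismAdj-sameRow n zero       i′ i = ∨-identityʳ _
prismAdj-sameRow n (suc zero) i′ i = ∨-identityʳ _

prismAdj-otherRow : ∀ n s (i′ i : Fin n) → prismAdj n (otherRow s , i′) (s , i) ≡ (toℕ i′ ≡ᵇ toℕ i)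
prismAdj-otherRow n zero       i′ i = refl
prismAdj-otherRow n (suc zero) i′ i = refl

rowDominated : Fin 2 → Column → Column → Column → Bool
rowDominated s p x q = row s x ∨ row (otherRow s) x ∨ row s p ∨ row s q

columnDominated : Column → Column → Column → Bool
columnDominated p x q = rowDominated zero p x q ∧ rowDominated (suc zero) p x q

columnDominated⇒rowDominated : ∀ s {p x q} → T (columnDominated p x q) → T (rowDominated s p x q)
columnDominated⇒rowDominated zero       = proj₁ ∘ Equivalence.to T-∧
columnDominated⇒rowDominated (suc zero) = proj₂ ∘ Equivalence.to T-∧

at : ∀ {n} → Word n → ℕ → Column
at []      _       = outside , outside
at (c ∷ w) zero    = c
at (c ∷ w) (suc j) = at w j

lookup≡at : ∀ {n} (w : Word n) i → Vec.lookup w i ≡ at w (toℕ i)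
lookup≡at (c ∷ w) zero    = refl
lookup≡at (c ∷ w) (suc i) = lookup≡at w i

∈ᵇ≡lookup : ∀ {m} (v : Fin m) S → (v ∈ᵇ S) ≡ Vec.lookup S v
∈ᵇ≡lookup v S with Vec.lookup S v
... | inside  = refl
... | outside = refl

vertex : ∀ {n} → Fin 2 → Fin n → Fin (2 * n)
vertex = combine

∈ᵇ-toSubset : ∀ {n} (w : Word n) s (i : Fin n) → (vertex s i ∈ᵇ toSubset w) ≡ row s (at w (toℕ i))
∈ᵇ-toSubset {n} w zero i = begin
  vertex zero i ∈ᵇ toSubset w                    ≡⟨ ∈ᵇ≡lookup (vertex zero i) (toSubset w) ⟩
  Vec.lookup (top Vec.++ bottom) (i ↑ˡ (n + 0))  ≡⟨ lookup-++ˡ top bottom i ⟩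
  Vec.lookup top i                               ≡⟨ lookup-map i proj₁ w ⟩
  proj₁ (Vec.lookup w i)                         ≡⟨ cong proj₁ (lookup≡at w i) ⟩
  proj₁ (at w (toℕ i))                           ∎
  where
  open ≡-Reasoning
  top : Subset n
  top = Vec.map proj₁ w
  bottom : Subset (n + 0)
  bottom = Vec.map proj₂ w Vec.++ []
∈ᵇ-toSubset {n} w (suc zero) i = begin
  vertex (suc zero) i ∈ᵇ toSubset w               ≡⟨ ∈ᵇ≡lookup (vertex (suc zero) i) (toSubset w) ⟩
  Vec.lookup (top Vec.++ bottom) (n ↑ʳ (i ↑ˡ 0))  ≡⟨ lookup-++ʳ top bottom (i ↑ˡ 0) ⟩
  Vec.lookup bottom (i ↑ˡ 0)                      ≡⟨ lookup-++ˡ (Vec.map proj₂ w) [] i ⟩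
  Vec.lookup (Vec.map proj₂ w) i                  ≡⟨ lookup-map i proj₂ w ⟩
  proj₂ (Vec.lookup w i)                          ≡⟨ cong proj₂ (lookup≡at w i) ⟩
  proj₂ (at w (toℕ i))                            ∎
  where
  open ≡-Reasoning
  top : Subset n
  top = Vec.map proj₁ w
  bottom : Subset (n + 0)
  bottom = Vec.map proj₂ w Vec.++ []

module _ {n} (w : Word n) where

  private
    S : Subset (2 * n)
    S = toSubset w

  dominatedᵇ : Fin (2 * n) → Bool
  dominatedᵇ v = (v ∈ᵇ S) ∨ anyᵇ (λ u → (u ∈ᵇ S) ∧ adj (Prism n) u v)

  rowDominatedAt : Fin 2 → ℕ → Bool
  rowDominatedAt s b = rowDominated s (at w (prev n b)) (at w b) (at w (next n b))

  RowDominatedAt : Fin 2 → ℕ → Set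
  RowDominatedAt s b = T (row s (at w b)) ⊎ T (row (otherRow s) (at w b)) ⊎
                       T (row s (at w (prev n b))) ⊎ T (row s (at w (next n b)))

  rowDominatedAt-sound : ∀ s b → T (rowDominatedAt s b) → RowDominatedAt s b
  rowDominatedAt-sound s b = ∨⁴-sound (row s (at w b)) _ _ _

  rowDominatedAt-complete : ∀ s b → RowDominatedAt s b → T (rowDominatedAt s b)
  rowDominatedAt-complete s b =
    ∨⁴-complete (row s (at w b)) (row (otherRow s) (at w b)) (row s (at w (prev n b))) (row s (at w (next n b)))

  columnDominatedAt : ℕ → Bool
  columnDominatedAt b = columnDominated (at w (prev n b)) (at w b) (at w (next n b))

  CyclicallyDominated : Set
  CyclicallyDominated = ∀ b → b < n → T (columnDominatedAt b)

  neighbour⇒rowDominated : ∀ s i s′ i′ → T (row s′ (at w (toℕ i′))) →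
                           T (prismAdj n (s′ , i′) (s , i)) → T (rowDominatedAt s (toℕ i))
  neighbour⇒rowDominated s i s′ i′ mem adj =
    rowDominatedAt-complete s (toℕ i) (byRow (sameRow⊎otherRow s s′))
    where
    byRow : s′ ≡ s ⊎ s′ ≡ otherRow s → RowDominatedAt s (toℕ i)
    byRow (inj₁ refl)
      with cycAdjℕ-sound (toℕ i′) (toℕ i) (toℕ<n i′) (subst T (prismAdj-sameRow n s i′ i) adj)
    ... | inj₁ i′≡prev = inj₂ (inj₂ (inj₁ (subst (λ k → T (row s (at w k))) i′≡prev mem)))
    ... | inj₂ i′≡next = inj₂ (inj₂ (inj₂ (subst (λ k → T (row s (at w k))) i′≡next mem)))
    byRow (inj₂ refl) = inj₂ (inj₁ (subst (λ k → T (row (otherRow s) (at w k))) i′≡i mem))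
      where
      i′≡i : toℕ i′ ≡ toℕ i
      i′≡i = ≡ᵇ⇒≡ (toℕ i′) (toℕ i) (subst T (prismAdj-otherRow n s i′ i) adj)

  dominated⇒rowDominated : ∀ s i → T (dominatedᵇ (vertex s i)) → T (rowDominatedAt s (toℕ i))
  dominated⇒rowDominated s i dom with Equivalence.to (T-∨ {vertex s i ∈ᵇ S}) dom
  ... | inj₁ mem = rowDominatedAt-complete s (toℕ i) (inj₁ (subst T (∈ᵇ-toSubset w s i) mem))
  ... | inj₂ any
    with u , u-adj ← anyᵇ-sound _ any
    with mem , adj ← Equivalence.to (T-∧ {u ∈ᵇ S}) u-adj
    = neighbour⇒rowDominated s i s′ i′
        (subst T (∈ᵇ-toSubset w s′ i′) (subst (λ v → T (v ∈ᵇ S)) (sym (combine-remQuot n u)) mem))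
        (subst (λ v → T (prismAdj n (s′ , i′) v)) (remQuot-combine s i) adj)
    where
    s′ = proj₁ (remQuot n u)
    i′ = proj₂ (remQuot n u)

  neighbour⇒dominated : ∀ s i s′ i′ → T (row s′ (at w (toℕ i′))) →
                        T (prismAdj n (s′ , i′) (s , i)) → T (dominatedᵇ (vertex s i))
  neighbour⇒dominated s i s′ i′ mem adj =
    Equivalence.from (T-∨ {vertex s i ∈ᵇ S}) (inj₂ (anyᵇ-complete _ (vertex s′ i′)
      (Equivalence.from (T-∧ {vertex s′ i′ ∈ᵇ S})
        ( subst T (sym (∈ᵇ-toSubset w s′ i′)) mem
        , subst (λ v → T (prismAdj n v (remQuot n (vertex s i)))) (sym (remQuot-combine s′ i′))
            (subst (λ v → T (prismAdj n (s′ , i′) v)) (sym (remQuot-combine s i)) adj)))))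

  sameRowNeighbour⇒dominated : ∀ s i {k} (k<n : k < n) → T (row s (at w k)) → T (cycAdjℕ n k (toℕ i)) →
                               T (dominatedᵇ (vertex s i))
  sameRowNeighbour⇒dominated s i k<n mem adj =
    neighbour⇒dominated s i s (fromℕ< k<n)
      (subst (λ k → T (row s (at w k))) (sym (toℕ-fromℕ< k<n)) mem)
      (subst T (sym (prismAdj-sameRow n s (fromℕ< k<n) i))
        (subst (λ k → T (cycAdjℕ n k (toℕ i))) (sym (toℕ-fromℕ< k<n)) adj))

  rowDominated⇒dominated : 2 ≤ n → ∀ s i → T (rowDominatedAt s (toℕ i)) → T (dominatedᵇ (vertex s i))
  rowDominated⇒dominated 2≤n s i rd with rowDominatedAt-sound s (toℕ i) rd
  ... | inj₁ self =
    Equivalence.from (T-∨ {vertex s i ∈ᵇ S}) (inj₁ (subst T (sym (∈ᵇ-toSubset w s i)) self))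
  ... | inj₂ (inj₁ other) =
    neighbour⇒dominated s i (otherRow s) i other
      (subst T (sym (prismAdj-otherRow n s i i)) (≡⇒≡ᵇ (toℕ i) (toℕ i) refl))
  ... | inj₂ (inj₂ (inj₁ left)) =
    sameRowNeighbour⇒dominated s i (prev<n (toℕ<n i)) left (cycAdjℕ-prev (toℕ i) 2≤n)
  ... | inj₂ (inj₂ (inj₂ right)) =
    sameRowNeighbour⇒dominated s i (next<n (toℕ<n i)) right (cycAdjℕ-next (toℕ i) 2≤n (toℕ<n i))

  isDominating⇒cyclicallyDominated : T (isDominating (Prism n) S) → CyclicallyDominated
  isDominating⇒cyclicallyDominated dom b b<n =
    subst (T ∘ columnDominatedAt) (toℕ-fromℕ< b<n)
      (Equivalence.from T-∧ ( dominated⇒rowDominated zero i (allᵇ-sound _ dom (vertex zero i))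
                            , dominated⇒rowDominated (suc zero) i (allᵇ-sound _ dom (vertex (suc zero) i))))
    where
    i = fromℕ< b<n

  cyclicallyDominated⇒isDominating : 2 ≤ n → CyclicallyDominated → T (isDominating (Prism n) S)
  cyclicallyDominated⇒isDominating 2≤n cd = allᵇ-complete _ λ v →
    let s , i = remQuot n v in
    subst (T ∘ dominatedᵇ) (combine-remQuot n v)
      (rowDominated⇒dominated 2≤n s i (columnDominated⇒rowDominated s (cd (toℕ i) (toℕ<n i))))

window : ∀ {m} → Word m → ℕ → Bool
window v j = columnDominated (at v j) (at v (suc j)) (at v (suc (suc j)))

windowsOk : ∀ {m} → Column → Column → Word m → Bool
windowsOk p x []      = true
windowsOk p x (q ∷ r) = columnDominated p x q ∧ windowsOk x q r

windowsOk-sound : ∀ {m} p x (r : Word m) → T (windowsOk p x r) → ∀ j → j < m → T (window (p ∷ x ∷ r) j)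
windowsOk-sound p x (q ∷ r) ok zero    _         = proj₁ (Equivalence.to (T-∧ {columnDominated p x q}) ok)
windowsOk-sound p x (q ∷ r) ok (suc j) (s≤s j<m) =
  windowsOk-sound x q r (proj₂ (Equivalence.to (T-∧ {columnDominated p x q}) ok)) j j<m

windowsOk-complete : ∀ {m} p x (r : Word m) → (∀ j → j < m → T (window (p ∷ x ∷ r) j)) →
                     T (windowsOk p x r)
windowsOk-complete p x []      ok = _
windowsOk-complete p x (q ∷ r) ok =
  Equivalence.from T-∧ (ok zero z<s , windowsOk-complete x q r (λ j j<m → ok (suc j) (s≤s j<m)))

at-++ˡ : ∀ {m k} (xs : Word m) (ys : Word k) {j} → j < m → at (xs Vec.++ ys) j ≡ at xs j
at-++ˡ (x ∷ xs) ys {zero}  _         = refl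
at-++ˡ (x ∷ xs) ys {suc j} (s≤s j<m) = at-++ˡ xs ys j<m

at-++ʳ : ∀ {m k} (xs : Word m) (ys : Word k) j → at (xs Vec.++ ys) (j + m) ≡ at ys j
at-++ʳ []       ys j = cong (at ys) (+-identityʳ j)
at-++ʳ (x ∷ xs) ys j = trans (cong (at (x ∷ xs Vec.++ ys)) (+-suc j _)) (at-++ʳ xs ys j)

columnDominated-cong : ∀ {p p′ x x′ q q′} → p ≡ p′ → x ≡ x′ → q ≡ q′ →
                       columnDominated p x q ≡ columnDominated p′ x′ q′
columnDominated-cong refl refl refl = refl

wrap : ∀ {L} → Word L → Column → Column → Word (L + 2)
wrap r c₀ c₁ = r Vec.++ c₀ ∷ c₁ ∷ []

-- Window j of x₀ x₁ (wrap r x₀ x₁) is the cyclic window of x₀ x₁ r centred at column j + 1.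
module _ {L} (x₀ x₁ : Column) (r : Word L) where

  private
    w : Word (suc (suc L))
    w = x₀ ∷ x₁ ∷ r

    ends : Word 2
    ends = x₀ ∷ x₁ ∷ []

    at-w : ∀ {j} → j < suc (suc L) → at (w Vec.++ ends) j ≡ at w j
    at-w = at-++ˡ w ends

  window-inner : ∀ {j} → j < L → window (w Vec.++ ends) j ≡ columnDominatedAt w (suc j)
  window-inner j<L = columnDominated-cong
    (at-w (m<n⇒m<1+n (m<n⇒m<1+n j<L)))
    (at-w (s≤s (m<n⇒m<1+n j<L)))
    (trans (at-w (s≤s (s≤s j<L))) (cong (at w) (sym (next-< (s≤s (s≤s j<L))))))

  window-last : window (w Vec.++ ends) L ≡ columnDominatedAt w (suc L)
  window-last = columnDominated-cong
    (at-w (m<n⇒m<1+n (n<1+n L)))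
    (at-w (n<1+n (suc L)))
    (trans (at-++ʳ r ends 0) (cong (at w) (sym (next-last (suc L)))))

  window-wrap : window (w Vec.++ ends) (suc L) ≡ columnDominatedAt w 0
  window-wrap = columnDominated-cong (at-w (n<1+n (suc L))) (at-++ʳ r ends 0) (at-++ʳ r ends 1)

  cyclicallyDominated⇒windowsOk : CyclicallyDominated w → T (windowsOk x₀ x₁ (wrap r x₀ x₁))
  cyclicallyDominated⇒windowsOk cd = windowsOk-complete x₀ x₁ (wrap r x₀ x₁) λ j j<L+2 →
    byPosition (subst (j <_) (+-comm L 2) j<L+2)
    where
    byPosition : ∀ {j} → j < suc (suc L) → T (window (w Vec.++ ends) j)
    byPosition {j} j<L+2 with m<1+n⇒m<n∨m≡n j<L+2
    ... | inj₂ refl = subst T (sym window-wrap) (cd 0 z<s)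
    ... | inj₁ j<L+1 with m<1+n⇒m<n∨m≡n j<L+1
    ...   | inj₁ j<L  = subst T (sym (window-inner j<L)) (cd (suc j) (s≤s (m<n⇒m<1+n j<L)))
    ...   | inj₂ refl = subst T (sym window-last) (cd (suc L) (n<1+n (suc L)))

  windowsOk⇒cyclicallyDominated : T (windowsOk x₀ x₁ (wrap r x₀ x₁)) → CyclicallyDominated w
  windowsOk⇒cyclicallyDominated ok = byPosition
    where
    window-ok : ∀ j → j < suc (suc L) → T (window (w Vec.++ ends) j)
    window-ok j j<L+2 = windowsOk-sound x₀ x₁ (wrap r x₀ x₁) ok j (subst (j <_) (+-comm 2 L) j<L+2)
    byPosition : CyclicallyDominated w
    byPosition zero    _           = subst T window-wrap (window-ok (suc L) (n<1+n (suc L)))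
    byPosition (suc b) (s≤s b<L+1) with m<1+n⇒m<n∨m≡n b<L+1
    ... | inj₁ b<L  = subst T (window-inner b<L) (window-ok b (m<n⇒m<1+n (m<n⇒m<1+n b<L)))
    ... | inj₂ refl = subst T window-last (window-ok L (m<n⇒m<1+n (n<1+n L)))

isDominating≡windowsOk : ∀ {L} x₀ x₁ (r : Word L) →
  isDominating (Prism (suc (suc L))) (toSubset (x₀ ∷ x₁ ∷ r)) ≡ windowsOk x₀ x₁ (wrap r x₀ x₁)
isDominating≡windowsOk x₀ x₁ r = T-extensional
  (cyclicallyDominated⇒windowsOk x₀ x₁ r ∘ isDominating⇒cyclicallyDominated (x₀ ∷ x₁ ∷ r))
  (cyclicallyDominated⇒isDominating (x₀ ∷ x₁ ∷ r) (s≤s (s≤s z≤n)) ∘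
   windowsOk⇒cyclicallyDominated x₀ x₁ r)

-- The number of members of the set in the closed neighbourhoods of the two vertices of column x.
coverage : Column → Column → Column → ℕ
coverage p x q = ∣ p ∣ᶜ + 2 * ∣ x ∣ᶜ + ∣ q ∣ᶜ

excess : Column → Column → Column → ℕ
excess p x q = coverage p x q ∸ 2

coverage-≥2 : ∀ p x q → T (columnDominated p x q) → 2 ≤ coverage p x q
coverage-≥2 p x q =
  ≤ᵇ⇒≤ 2 (coverage p x q) ∘ T-implication (Finite.all-sound triples implication _ (p , x , q))
  where
  triples = ×-finite columnFinite (×-finite columnFinite columnFinite)
  implication : Column × Column × Column → Bool
  implication (p , x , q) = not (columnDominated p x q) ∨ (2 ≤ᵇ coverage p x q)

windowsCoverage : ∀ {m} → Column → Column → Word m → ℕ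
windowsCoverage p x []      = 0
windowsCoverage p x (q ∷ r) = coverage p x q + windowsCoverage x q r

windowsExcess : ∀ {m} → Column → Column → Word m → ℕ
windowsExcess p x []      = 0
windowsExcess p x (q ∷ r) = excess p x q + windowsExcess x q r

windowsCoverage-++ : ∀ {m} p x (r : Word m) y z →
  windowsCoverage p x (r Vec.++ y ∷ z ∷ []) ≡ ∣ p ∣ᶜ + 3 * ∣ x ∣ᶜ + 4 * weight r + 3 * ∣ y ∣ᶜ + ∣ z ∣ᶜ
windowsCoverage-++ p x []      y z = base ∣ p ∣ᶜ ∣ x ∣ᶜ ∣ y ∣ᶜ ∣ z ∣ᶜ
  where
  base : ∀ a b c d → (a + 2 * b + c) + ((b + 2 * c + d) + 0) ≡ a + 3 * b + 4 * 0 + 3 * c + d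
  base = solve-∀
windowsCoverage-++ p x (q ∷ r) y z =
  trans (cong (coverage p x q +_) (windowsCoverage-++ x q r y z))
        (shift ∣ p ∣ᶜ ∣ x ∣ᶜ ∣ q ∣ᶜ (weight r) ∣ y ∣ᶜ ∣ z ∣ᶜ)
  where
  shift : ∀ a b c R d e →
          (a + 2 * b + c) + (b + 3 * c + 4 * R + 3 * d + e) ≡ a + 3 * b + 4 * (c + R) + 3 * d + e
  shift = solve-∀

windowsCoverage-cyclic : ∀ {L} x₀ x₁ (r : Word L) →
  windowsCoverage x₀ x₁ (wrap r x₀ x₁) ≡ 4 * weight (x₀ ∷ x₁ ∷ r)
windowsCoverage-cyclic x₀ x₁ r =
  trans (windowsCoverage-++ x₀ x₁ r x₀ x₁) (regroup ∣ x₀ ∣ᶜ ∣ x₁ ∣ᶜ (weight r))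
  where
  regroup : ∀ a b R → a + 3 * b + 4 * R + 3 * a + b ≡ 4 * (a + (b + R))
  regroup = solve-∀

windowsCoverage≡2*+excess : ∀ {m} p x (r : Word m) → T (windowsOk p x r) →
                            windowsCoverage p x r ≡ m * 2 + windowsExcess p x r
windowsCoverage≡2*+excess p x []      _  = refl
windowsCoverage≡2*+excess {suc m} p x (q ∷ r) ok = begin
  coverage p x q + windowsCoverage x q r
    ≡⟨ cong₂ _+_ (sym (m+[n∸m]≡n (coverage-≥2 p x q dominated))) (windowsCoverage≡2*+excess x q r rest) ⟩
  (2 + excess p x q) + (m * 2 + windowsExcess x q r)
    ≡⟨ cong (2 +_) (x∙yz≈y∙xz (excess p x q) (m * 2) (windowsExcess x q r)) ⟩
  (2 + m * 2) + (excess p x q + windowsExcess x q r) ∎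
  where
  open ≡-Reasoning
  dominated = proj₁ (Equivalence.to (T-∧ {columnDominated p x q}) ok)
  rest      = proj₂ (Equivalence.to (T-∧ {columnDominated p x q}) ok)

4*weight≡ : ∀ {L} x₀ x₁ (r : Word L) → T (windowsOk x₀ x₁ (wrap r x₀ x₁)) →
            4 * weight (x₀ ∷ x₁ ∷ r) ≡ 2 * suc (suc L) + windowsExcess x₀ x₁ (wrap r x₀ x₁)
4*weight≡ {L} x₀ x₁ r ok = begin
  4 * weight (x₀ ∷ x₁ ∷ r)                  ≡⟨ windowsCoverage-cyclic x₀ x₁ r ⟨
  windowsCoverage x₀ x₁ rx                   ≡⟨ windowsCoverage≡2*+excess x₀ x₁ rx ok ⟩
  (L + 2) * 2 + windowsExcess x₀ x₁ rx       ≡⟨ cong (_+ windowsExcess x₀ x₁ rx) (double L) ⟩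
  2 * suc (suc L) + windowsExcess x₀ x₁ rx   ∎
  where
  open ≡-Reasoning
  rx = wrap r x₀ x₁
  double : ∀ L → (L + 2) * 2 ≡ 2 * suc (suc L)
  double = solve-∀

-- The transfer operator

data Slack : Set where
  0ˢ 1ˢ 2ˢ : Slack

slack : Slack → ℕ
slack 0ˢ = 0
slack 1ˢ = 1
slack 2ˢ = 2

spend : Slack → ℕ → Maybe Slack
spend 0ˢ 0 = just 0ˢ
spend 1ˢ 0 = just 1ˢ
spend 1ˢ 1 = just 0ˢ
spend 2ˢ 0 = just 2ˢ
spend 2ˢ 1 = just 1ˢ
spend 2ˢ 2 = just 0ˢ
spend _  _ = nothing

spend-≡ᵇ : ∀ t e E → (e + E ≡ᵇ slack t) ≡ maybe (λ t′ → E ≡ᵇ slack t′) false (spend t e)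
spend-≡ᵇ 0ˢ 0                   E = refl
spend-≡ᵇ 0ˢ (suc e)             E = refl
spend-≡ᵇ 1ˢ 0                   E = refl
spend-≡ᵇ 1ˢ 1                   E = refl
spend-≡ᵇ 1ˢ (suc (suc e))       E = refl
spend-≡ᵇ 2ˢ 0                   E = refl
spend-≡ᵇ 2ˢ 1                   E = refl
spend-≡ᵇ 2ˢ 2                   E = refl
spend-≡ᵇ 2ˢ (suc (suc (suc e))) E = refl

slackFinite : Finite Slack
slackFinite = record
  { Table           = λ A → A × A × A
  ; tabulate        = λ f → f 0ˢ , f 1ˢ , f 2ˢ
  ; lookup          = λ { (a , b , c) 0ˢ → a ; (a , b , c) 1ˢ → b ; (a , b , c) 2ˢ → c }
  ; lookup∘tabulate = λ { f 0ˢ → refl ; f 1ˢ → refl ; f 2ˢ → refl }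
  ; all             = λ p → p 0ˢ ∧ p 1ˢ ∧ p 2ˢ
  ; all-sound       = λ { p ok 0ˢ → proj₁ (Equivalence.to (T-∧ {p 0ˢ}) ok)
                        ; p ok 1ˢ → proj₁ (Equivalence.to (T-∧ {p 1ˢ}) (proj₂ (Equivalence.to (T-∧ {p 0ˢ}) ok)))
                        ; p ok 2ˢ → proj₂ (Equivalence.to (T-∧ {p 1ˢ}) (proj₂ (Equivalence.to (T-∧ {p 0ˢ}) ok))) }
  }

-- (c₀ , c₁ , p , x , t): first two columns of the word, which close the cycle, its last two
-- columns so far, and the part of the allowed total excess not yet spent.
State : Set
State = Column × Column × Column × Column × Slack

module States = Finite
  (×-finite columnFinite (×-finite columnFinite (×-finite columnFinite (×-finite columnFinite slackFinite))))

step : (State → ℕ) → State → Column → ℕ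
step f (c₀ , c₁ , p , x , t) q =
  if columnDominated p x q then maybe (λ t′ → f (c₀ , c₁ , x , q , t′)) 0 (spend t (excess p x q)) else 0

transfer : (State → ℕ) → State → ℕ
transfer f s = sumOver columns (step f s)

transferⁿ : ℕ → (State → ℕ) → State → ℕ
transferⁿ zero    f = f
transferⁿ (suc k) f = transfer (transferⁿ k f)

completionOk : ∀ {m} → State → Word m → Bool
completionOk (c₀ , c₁ , p , x , t) r =
  windowsOk p x (wrap r c₀ c₁) ∧ (windowsExcess p x (wrap r c₀ c₁) ≡ᵇ slack t)

completions : ℕ → State → ℕ
completions L s = sumOver (words L) (𝟙 ∘ completionOk s)

closing : State → ℕ
closing s = 𝟙 (completionOk s [])

step-linear : ∀ s → Linear (λ f → step f s)
step-linear (c₀ , c₁ , p , x , t) j f≗g+jh q with columnDominated p x q | spend t (excess p x q)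
... | false | _       = sym (*-zeroʳ j)
... | true  | nothing = sym (*-zeroʳ j)
... | true  | just t′ = f≗g+jh (c₀ , c₁ , x , q , t′)

transfer-linear : Linear transfer
transfer-linear j f≗g+jh s = sumOver-linear columns j (step-linear s j f≗g+jh)

transferⁿ-linear : ∀ k → Linear (transferⁿ k)
transferⁿ-linear zero    j f≗g+jh = f≗g+jh
transferⁿ-linear (suc k) = Linear-∘ transfer-linear (transferⁿ-linear k)

sumOver-𝟙-spend : ∀ (xs : List A) a (b : A → Bool) (E : A → ℕ) t e →
  sumOver xs (λ r → 𝟙 ((a ∧ b r) ∧ (e + E r ≡ᵇ slack t))) ≡
  (if a then maybe (λ t′ → sumOver xs (λ r → 𝟙 (b r ∧ (E r ≡ᵇ slack t′)))) 0 (spend t e) else 0)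
sumOver-𝟙-spend xs false b E t e = sumOver-zero xs
sumOver-𝟙-spend xs true  b E t e =
  trans (sumOver-cong xs (λ r → cong (λ z → 𝟙 (b r ∧ z)) (spend-≡ᵇ t e (E r)))) (bySpend (spend t e))
  where
  bySpend : ∀ m → sumOver xs (λ r → 𝟙 (b r ∧ maybe (λ t′ → E r ≡ᵇ slack t′) false m)) ≡
                  maybe (λ t′ → sumOver xs (λ r → 𝟙 (b r ∧ (E r ≡ᵇ slack t′)))) 0 m
  bySpend nothing   = trans (sumOver-cong xs (λ r → cong 𝟙 (∧-zeroʳ (b r)))) (sumOver-zero xs)
  bySpend (just t′) = refl

completions-suc : ∀ L s → completions (suc L) s ≡ transfer (completions L) s
completions-suc L s@(c₀ , c₁ , p , x , t) =
  trans (sumOver-words-suc L (𝟙 ∘ completionOk s)) (sumOver-cong columns λ q →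
    sumOver-𝟙-spend (words L) (columnDominated p x q) (λ r → windowsOk x q (wrap r c₀ c₁))
                    (λ r → windowsExcess x q (wrap r c₀ c₁)) t (excess p x q))

completions≡transferⁿ : ∀ L s → completions L s ≡ transferⁿ L closing s
completions≡transferⁿ zero    s = +-identityʳ _
completions≡transferⁿ (suc L) s =
  trans (completions-suc L s) (Linear⇒cong transfer-linear (completions≡transferⁿ L) s)

-- Memoised transferⁿ: each level is evaluated once, not once per path through the lower levels.
transferTable : ℕ → (State → ℕ) → States.Table ℕ
transferTable zero    f = States.tabulate f
transferTable (suc k) f = States.tabulate (transfer (States.lookup (transferTable k f)))

lookup-transferTable : ∀ k f s → States.lookup (transferTable k f) s ≡ transferⁿ k f s
lookup-transferTable zero    f s = States.lookup∘tabulate f s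
lookup-transferTable (suc k) f s =
  trans (States.lookup∘tabulate (transfer (States.lookup (transferTable k f))) s)
        (Linear⇒cong transfer-linear (lookup-transferTable k f) s)

growth : ℕ → State → ℕ
growth L₀ = States.lookup (States.tabulate λ s →
  States.lookup (transferTable (4 + L₀) closing) s ∸ States.lookup (transferTable L₀ closing) s)

-- Named, so that the type checker never unfolds these tables under a variable L₀: it would
-- evaluate them symbolically, which is infeasible.
growthStep : ℕ → State → Bool
growthStep L₀ s =
  States.lookup (transferTable (4 + L₀) closing) s ≡ᵇ States.lookup (transferTable L₀ closing) s + growth L₀ s

growthFixed : ℕ → State → Bool
growthFixed L₀ s = States.lookup (transferTable 4 (growth L₀)) s ≡ᵇ growth L₀ s

transferⁿ-affine : ∀ L₀ → T (States.all (growthStep L₀)) → T (States.all (growthFixed L₀)) →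
  ∀ i s → transferⁿ (i * 4 + L₀) closing s ≡ transferⁿ L₀ closing s + i * growth L₀ s
transferⁿ-affine L₀ stepOk fixedOk =
  affine-orbit (transferⁿ-linear 4) (λ i → transferⁿ (i * 4 + L₀) closing) (growth L₀)
    (λ i s → refl) first fixed
  where
  first : ∀ s → transferⁿ (4 + L₀) closing s ≡ transferⁿ L₀ closing s + growth L₀ s
  first s = trans (sym (lookup-transferTable (4 + L₀) closing s))
    (trans (≡ᵇ⇒≡ (States.lookup (transferTable (4 + L₀) closing) s)
                 (States.lookup (transferTable L₀ closing) s + growth L₀ s)
                 (States.all-sound (growthStep L₀) stepOk s))
           (cong (_+ growth L₀ s) (lookup-transferTable L₀ closing s)))
  fixed : ∀ s → transferⁿ 4 (growth L₀) s ≡ growth L₀ s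
  fixed s = trans (sym (lookup-transferTable 4 (growth L₀) s))
    (≡ᵇ⇒≡ (States.lookup (transferTable 4 (growth L₀)) s) (growth L₀ s)
          (States.all-sound (growthFixed L₀) fixedOk s))

transferⁿ-4i+5 : ∀ i s → transferⁿ (i * 4 + 5) closing s ≡ transferⁿ 5 closing s + i * growth 5 s
transferⁿ-4i+5 = transferⁿ-affine 5 _ _

transferⁿ-4i+7 : ∀ i s → transferⁿ (i * 4 + 7) closing s ≡ transferⁿ 7 closing s + i * growth 7 s
transferⁿ-4i+7 = transferⁿ-affine 7 _ _

startSum : (State → ℕ) → ℕ
startSum f = sumOver columns (λ x₀ → sumOver columns (λ x₁ → f (x₀ , x₁ , x₀ , x₁ , 2ˢ)))

startSum-cong : ∀ {f g} → (∀ s → f s ≡ g s) → startSum f ≡ startSum g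
startSum-cong f≗g =
  sumOver-cong columns λ x₀ → sumOver-cong columns λ x₁ → f≗g (x₀ , x₁ , x₀ , x₁ , 2ˢ)

startSum-linear : ∀ {f g h} j → (∀ s → f s ≡ g s + j * h s) → startSum f ≡ startSum g + j * startSum h
startSum-linear j f≗g+jh =
  sumOver-linear columns j λ x₀ → sumOver-linear columns j λ x₁ → f≗g+jh (x₀ , x₁ , x₀ , x₁ , 2ˢ)

startSum-transferTable : ∀ k →
  startSum (States.lookup (transferTable k closing)) ≡ startSum (transferⁿ k closing)
startSum-transferTable k = startSum-cong (lookup-transferTable k closing)

startSum-4i+5 : ∀ i → startSum (transferⁿ (i * 4 + 5) closing) ≡ 14 + i * 8
startSum-4i+5 i = begin
  startSum (transferⁿ (i * 4 + 5) closing)                 ≡⟨ startSum-linear i (transferⁿ-4i+5 i) ⟩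
  startSum (transferⁿ 5 closing) + i * startSum (growth 5)  ≡⟨ cong (_+ i * 8) (startSum-transferTable 5) ⟨
  14 + i * 8                                                ∎
  where open ≡-Reasoning

startSum-4i+7 : ∀ i → startSum (transferⁿ (i * 4 + 7) closing) ≡ 18 + i * 8
startSum-4i+7 i = begin
  startSum (transferⁿ (i * 4 + 7) closing)                 ≡⟨ startSum-linear i (transferⁿ-4i+7 i) ⟩
  startSum (transferⁿ 7 closing) + i * startSum (growth 7)  ≡⟨ cong (_+ i * 8) (startSum-transferTable 7) ⟨
  18 + i * 8                                                ∎
  where open ≡-Reasoning

parity : ∀ m → ∃ λ i → m ≡ i * 2 ⊎ m ≡ suc (i * 2)
parity zero = 0 , inj₁ refl
parity (suc m) with parity m
... | i , inj₁ refl = i , inj₂ refl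
... | i , inj₂ refl = suc i , inj₁ refl

startSum-odd : ∀ m → startSum (transferⁿ (suc m * 2 + 1) closing) ≡ 2 * suc (suc (suc m * 2 + 1))
startSum-odd m with parity m
... | zero  , inj₁ refl = sym (startSum-transferTable 3)
... | suc i , inj₁ refl = begin
  startSum (transferⁿ (suc (suc i * 2) * 2 + 1) closing)
    ≡⟨ cong (λ L → startSum (transferⁿ L closing)) (index i) ⟩
  startSum (transferⁿ (i * 4 + 7) closing)
    ≡⟨ startSum-4i+7 i ⟩
  18 + i * 8
    ≡⟨ value i ⟩
  2 * suc (suc (suc (suc i * 2) * 2 + 1)) ∎
  where
  open ≡-Reasoning
  index : ∀ i → suc (suc i * 2) * 2 + 1 ≡ i * 4 + 7
  index = solve-∀
  value : ∀ i → 18 + i * 8 ≡ 2 * suc (suc (suc (suc i * 2) * 2 + 1))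
  value = solve-∀
... | i , inj₂ refl = begin
  startSum (transferⁿ (suc (suc (i * 2)) * 2 + 1) closing)
    ≡⟨ cong (λ L → startSum (transferⁿ L closing)) (index i) ⟩
  startSum (transferⁿ (i * 4 + 5) closing)
    ≡⟨ startSum-4i+5 i ⟩
  14 + i * 8
    ≡⟨ value i ⟩
  2 * suc (suc (suc (suc (i * 2)) * 2 + 1)) ∎
  where
  open ≡-Reasoning
  index : ∀ i → suc (suc (i * 2)) * 2 + 1 ≡ i * 4 + 5
  index = solve-∀
  value : ∀ i → 14 + i * 8 ≡ 2 * suc (suc (suc (suc (i * 2)) * 2 + 1))
  value = solve-∀

module _ (L c : ℕ) (4c≡2n+2 : 4 * c ≡ 2 * suc (suc L) + 2) where

  private
    n : ℕ
    n = suc (suc L)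

  weight≡ᵇc≡excess≡ᵇ2 : ∀ x₀ x₁ (r : Word L) → T (windowsOk x₀ x₁ (wrap r x₀ x₁)) →
    (weight (x₀ ∷ x₁ ∷ r) ≡ᵇ c) ≡ (windowsExcess x₀ x₁ (wrap r x₀ x₁) ≡ᵇ 2)
  weight≡ᵇc≡excess≡ᵇ2 x₀ x₁ r ok = T-extensional
    (λ W≡c → ≡⇒≡ᵇ E 2 (+-cancelˡ-≡ (2 * n) E 2
      (trans (sym (4*weight≡ x₀ x₁ r ok)) (trans (cong (4 *_) (≡ᵇ⇒≡ W c W≡c)) 4c≡2n+2))))
    (λ E≡2 → ≡⇒≡ᵇ W c (*-cancelˡ-≡ W c 4
      (trans (4*weight≡ x₀ x₁ r ok) (trans (cong (2 * n +_) (≡ᵇ⇒≡ E 2 E≡2)) (sym 4c≡2n+2)))))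
    where
    W = weight (x₀ ∷ x₁ ∷ r)
    E = windowsExcess x₀ x₁ (wrap r x₀ x₁)

  c≤weight : ∀ x₀ x₁ (r : Word L) → T (windowsOk x₀ x₁ (wrap r x₀ x₁)) →
             c ≤ weight (x₀ ∷ x₁ ∷ r)
  c≤weight x₀ x₁ r ok = m<1+n⇒m≤n (*-cancelˡ-< 4 c (suc W) (begin-strict
    4 * c          ≡⟨ 4c≡2n+2 ⟩
    2 * n + 2      ≤⟨ +-monoˡ-≤ 2 (m≤m+n (2 * n) E) ⟩
    2 * n + E + 2  ≡⟨ cong (_+ 2) (4*weight≡ x₀ x₁ r ok) ⟨
    4 * W + 2      <⟨ +-monoʳ-< (4 * W) (s≤s (s≤s (s≤s z≤n))) ⟩
    4 * W + 4      ≡⟨ trans (*-suc 4 W) (+-comm 4 (4 * W)) ⟨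
    4 * suc W      ∎))
    where
    open ≤-Reasoning
    W = weight (x₀ ∷ x₁ ∷ r)
    E = windowsExcess x₀ x₁ (wrap r x₀ x₁)

  isDominatingOfSize-toSubset : ∀ x₀ x₁ (r : Word L) →
    isDominatingOfSize (Prism n) c (toSubset (x₀ ∷ x₁ ∷ r)) ≡ completionOk (x₀ , x₁ , x₀ , x₁ , 2ˢ) r
  isDominatingOfSize-toSubset x₀ x₁ r =
    trans (cong₂ (λ d k → d ∧ (k ≡ᵇ c)) (isDominating≡windowsOk x₀ x₁ r) (∣toSubset∣ (x₀ ∷ x₁ ∷ r)))
          (∧-cong-T (windowsOk x₀ x₁ (wrap r x₀ x₁)) (weight≡ᵇc≡excess≡ᵇ2 x₀ x₁ r))

  #dominatingOfSize≡startSum : #dominatingOfSize (Prism n) c ≡ startSum (transferⁿ L closing)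
  #dominatingOfSize≡startSum = begin
    sumOver (allSubsets (2 * n)) (𝟙 ∘ ofSize-c)
      ≡⟨ sumOver-allSubsets-2* n (𝟙 ∘ ofSize-c) ⟩
    sumOver (words n) (𝟙 ∘ ofSize-c ∘ toSubset)
      ≡⟨ sumOver-words-suc (suc L) (𝟙 ∘ ofSize-c ∘ toSubset) ⟩
    sumOver columns (λ x₀ → sumOver (words (suc L)) (λ w → 𝟙 (ofSize-c (toSubset (x₀ ∷ w)))))
      ≡⟨ sumOver-cong columns (λ x₀ → sumOver-words-suc L (λ w → 𝟙 (ofSize-c (toSubset (x₀ ∷ w))))) ⟩
    sumOver columns (λ x₀ → sumOver columns (λ x₁ →
      sumOver (words L) (λ r → 𝟙 (ofSize-c (toSubset (x₀ ∷ x₁ ∷ r))))))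
      ≡⟨ sumOver-cong columns (λ x₀ → sumOver-cong columns (λ x₁ → sumOver-cong (words L) (λ r →
           cong 𝟙 (isDominatingOfSize-toSubset x₀ x₁ r)))) ⟩
    startSum (completions L)
      ≡⟨ startSum-cong (completions≡transferⁿ L) ⟩
    startSum (transferⁿ L closing) ∎
    where
    open ≡-Reasoning
    ofSize-c = isDominatingOfSize (Prism n) c

  c≤dominating : ∀ S → T (isDominating (Prism n) S) → c ≤ ∣ S ∣
  c≤dominating S dom with toSubset-surjective n S
  ... | x₀ ∷ x₁ ∷ r , refl =
    subst (c ≤_) (sym (∣toSubset∣ (x₀ ∷ x₁ ∷ r)))
      (c≤weight x₀ x₁ r (subst T (isDominating≡windowsOk x₀ x₁ r) dom))

  ζ-Prism : startSum (transferⁿ L closing) ≡ 2 * n → ζ (Prism n) ≡ 2 * n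
  ζ-Prism count = begin
    ζ (Prism n)                                ≡⟨ ζ≡#dominatingOfSize (Prism n) ⟩
    #dominatingOfSize (Prism n) (γ (Prism n))  ≡⟨ cong (#dominatingOfSize (Prism n)) γ≡c ⟩
    #dominatingOfSize (Prism n) c              ≡⟨ #≡2n ⟩
    2 * n                                      ∎
    where
    open ≡-Reasoning
    #≡2n = trans #dominatingOfSize≡startSum count
    γ≡c  = attainedLowerBound⇒γ≡ (Prism n) c≤dominating (λ #≡0 → 0≢1+n (trans (sym #≡0) #≡2n))

ζ-Prism-odd : ∀ m → ζ (Prism (2 * suc (suc m) + 1)) ≡ 2 * (2 * suc (suc m) + 1)
ζ-Prism-odd m =
  subst (λ n → ζ (Prism n) ≡ 2 * n) (n≡ m) (ζ-Prism (suc m * 2 + 1) (m + 3) (4c≡2n+2 m) (startSum-odd m))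
  where
  n≡ : ∀ m → suc (suc (suc m * 2 + 1)) ≡ 2 * suc (suc m) + 1
  n≡ = solve-∀
  4c≡2n+2 : ∀ m → 4 * (m + 3) ≡ 2 * suc (suc (suc m * 2 + 1)) + 2
  4c≡2n+2 = solve-∀

corollary3p8 : (n : ℕ) → 5 ≤ n → (∃ λ k → n ≡ 2 * k + 1) → ζ (Prism n) ≡ 2 * n
corollary3p8 _ 5≤n (k , refl) = odd k 5≤n
  where
  odd : ∀ k → 5 ≤ 2 * k + 1 → ζ (Prism (2 * k + 1)) ≡ 2 * (2 * k + 1)
  odd 0             (s≤s ())
  odd 1             (s≤s (s≤s (s≤s ())))
  odd (suc (suc m)) _ = ζ-Prism-odd m
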